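{- There exists a $CS(3,K_4^{(3)}+e,gn)$ of type $(g^n:0)$ for each $(g,n)\in\{(5,3),(5,5),(10,2),(15,2)\}$.
   Context: $K_4^{(3)}+e$ denotes the 3-uniform hypergraph with vertex set $\{1,2,3,4,5\}$ and edge set $\{\{1,2,3\},\{1,2,4\},\{1,3,4\},\{2,3,4\},\{3,4,5\}\}$. A $CS(3,K_4^{(3)}+e,gn+s)$ of type $(g^n:s)$ is a quadruple $(X,S,\mathcal{T},\mathcal{A})$ where $X$ is a set of $gn+s$ points, $S\subseteq X$ with $|S|=s$ (the stem), $\mathcal{T}=\{G_1,\dots,G_n\}$ is a partition of $X\setminus S$ into $n$ groups of size $g$, and $\mathcal{A}$ is a collection of hypergraphs (blocks) on subsets of $X$, each isomorphic to $K_4^{(3)}+e$, such that every 3-subset $T\subseteq X$ with $|T\cap(S\cup G_i)|<3$ for all $i$ is an edge of exactly one block, and no 3-subset of any $S\cup G_i$ is an edge of any block. Here $s=0$. -}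

module Defs where

open import Data.Nat using (ℕ; _+_; _*_; _<_; _≤_)
open import Data.Fin using (Fin) renaming (zero to f0; suc to fs)
open import Data.Fin.Subset using (Subset; ⁅_⁆; _∪_; _∩_; ∣_∣)
open import Data.Fin.Properties using (_≟_)
open import Data.Vec using (tabulate)
open import Data.Vec.Properties using (≡-dec)
open import Data.Bool using (Bool; true; false)
open import Data.Bool.Properties renaming (_≟_ to _≟ᵇ_)
open import Data.Maybe using (Maybe; just; nothing)
open import Data.List using (List; []; _∷_; length; filter; concatMap)
open import Data.Product using (Σ; ∃; _×_; _,_; proj₁)
open import Function.Definitions using (Injective)
open import Relation.Binary.PropositionalEquality using (_≡_)
open import Relation.Nullary using (does)

-- Vertices 0..4 of K_4^(3)+e correspond to the paper's 1..5.
-- Edge list: {1,2,3},{1,2,4},{1,3,4},{2,3,4},{3,4,5}.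
v0 v1 v2 v3 v4 : Fin 5
v0 = f0
v1 = fs f0
v2 = fs (fs f0)
v3 = fs (fs (fs f0))
v4 = fs (fs (fs (fs f0)))

triple : ∀ {N} → Fin N → Fin N → Fin N → Subset N
triple a b c = ⁅ a ⁆ ∪ ⁅ b ⁆ ∪ ⁅ c ⁆

-- A block on point set Fin N: an injective placement of the 5 vertices
-- (a copy of K_4^(3)+e).
Block : ℕ → Set
Block N = Σ (Fin 5 → Fin N) (Injective _≡_ _≡_)

blockEdges : ∀ {N} → Block N → List (Subset N)
blockEdges (f , _) =
  triple (f v0) (f v1) (f v2) ∷ triple (f v0) (f v1) (f v3) ∷
  triple (f v0) (f v2) (f v3) ∷ triple (f v1) (f v2) (f v3) ∷
  triple (f v2) (f v3) (f v4) ∷ []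

-- Number of blocks of 𝒜 having T as an edge (each block has distinct edges).
edgeCount : ∀ {N} → List (Block N) → Subset N → ℕ
edgeCount 𝒜 T = length (filter (λ E → ≡-dec _≟ᵇ_ E T) (concatMap blockEdges 𝒜))

-- Point labelling: nothing = stem point, just i = point of group G_i.
StemSet : ∀ {N n} → (Fin N → Maybe (Fin n)) → Subset N
StemSet lab = tabulate λ x → isNothing (lab x)
  where
  isNothing : ∀ {A : Set} → Maybe A → Bool
  isNothing nothing = true
  isNothing (just _) = false

GroupSet : ∀ {N n} → (Fin N → Maybe (Fin n)) → Fin n → Subset N
GroupSet lab i = tabulate λ x → isIn (lab x)
  where
  isIn : Maybe (Fin _) → Bool
  isIn nothing = false
  isIn (just j) = does (j ≟ i)

-- CS(3, K_4^(3)+e, gn+s) of type (g^n : s), on point set X = Fin (g*n+s).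
-- lab describes the stem S and the partition T = {G_1,…,G_n} of X∖S.
record IsCS (g n s : ℕ) (lab : Fin (g * n + s) → Maybe (Fin n))
            (𝒜 : List (Block (g * n + s))) : Set where
  field
    stemSize  : ∣ StemSet lab ∣ ≡ s
    groupSize : ∀ i → ∣ GroupSet lab i ∣ ≡ g
    covered   : ∀ (T : Subset (g * n + s)) → ∣ T ∣ ≡ 3 →
                (∀ i → ∣ T ∩ (StemSet lab ∪ GroupSet lab i) ∣ < 3) →
                edgeCount 𝒜 T ≡ 1
    noInside  : ∀ (T : Subset (g * n + s)) → ∣ T ∣ ≡ 3 → ∀ i →
                3 ≤ ∣ T ∩ (StemSet lab ∪ GroupSet lab i) ∣ →
                edgeCount 𝒜 T ≡ 0

CSExists : ℕ → ℕ → ℕ → Set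
CSExists g n s = ∃ λ (lab : Fin (g * n + s) → Maybe (Fin n)) →
                 ∃ λ (𝒜 : List (Block (g * n + s))) → IsCS g n s lab 𝒜

module Submission where

-- Lemma 3.4 asserts the existence of four specific designs, so the proof
-- exhibits them: for each (g,n) the points 0,…,gn-1 are split into n groups
-- of g consecutive points and an explicit list of blocks is given.

open import Agda.Builtin.FromNat using (Number; fromNat)
open import Data.Bool using (Bool; true; false; T; _∧_; if_then_else_)
open import Data.Bool.Properties using (T-∧) renaming (_≟_ to _≟ᵇ_)
open import Data.Empty using (⊥-elim)
open import Data.Fin using (Fin; cast; quotient)
import Data.Fin.Literals as Fin
open import Data.Fin.Properties using (_≟_; all?)
open import Data.Fin.Subset using (Subset; _∪_; _∩_; ∣_∣)
open import Data.List using (List; []; _∷_; length; filter; concatMap)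
open import Data.Maybe using (Maybe; just)
open import Data.Nat using (ℕ; zero; suc; _+_; _*_; _<_; _≤_; _<?_; _≤?_)
  renaming (_≟_ to _≟ℕ_)
import Data.Nat.Literals as ℕ
open import Data.Nat.Properties using (+-suc; +-identityʳ; *-comm; m≤m+n)
open import Data.Product using (_×_; _,_; proj₁; proj₂)
open import Data.Unit using (⊤; tt)
open import Data.Vec using ([]; _∷_; head; tail; lookup)
open import Data.Vec.Properties using (≡-dec)
open import Function using (_∘_; Equivalence)
open import Relation.Binary.PropositionalEquality using (_≡_; refl; sym; trans; cong; subst)
open import Relation.Nullary using (Dec; yes; no; does; _×-dec_; _→-dec_)
open import Relation.Nullary.Decidable using (True; isYes; toWitness)

open import Defs

-- Numerals denote natural numbers, and elements of Fin N when below N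
-- (so that blocks can be written as `block 0 11 6 14 3`).
instance
  natLiterals : Number ℕ
  natLiterals = ℕ.number

  natLiteralsConstraint : ⊤
  natLiteralsConstraint = tt

  finLiterals : ∀ {N} → Number (Fin N)
  finLiterals {N} = Fin.number N

injective? : ∀ {m N} (f : Fin m → Fin N) → Dec (∀ x y → f x ≡ f y → x ≡ y)
injective? f = all? λ x → all? λ y → (f x ≟ f y) →-dec (x ≟ y)

vertices : ∀ {N} → Fin N → Fin N → Fin N → Fin N → Fin N → Fin 5 → Fin N
vertices a b c d e = lookup (a ∷ b ∷ c ∷ d ∷ e ∷ [])

block : ∀ {N} (a b c d e : Fin N) → {True (injective? (vertices a b c d e))} → Block N
block a b c d e {distinct} = vertices a b c d e , λ {x} {y} → toWitness distinct x y

count : ∀ {m} → List (Subset m) → Subset m → ℕ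
count L X = length (filter (λ E → ≡-dec _≟ᵇ_ E X) L)

restrict : ∀ {m} → Bool → List (Subset (suc m)) → List (Subset m)
restrict b [] = []
restrict b ((x ∷ E) ∷ L) = if does (x ≟ᵇ b) then E ∷ restrict b L else restrict b L

count-restrict : ∀ {m} (L : List (Subset (suc m))) b X → count L (b ∷ X) ≡ count (restrict b L) X
count-restrict [] b X = refl
count-restrict ((false ∷ E) ∷ L) false X with does (≡-dec _≟ᵇ_ E X)
... | true = cong suc (count-restrict L false X)
... | false = count-restrict L false X
count-restrict ((false ∷ E) ∷ L) true X = count-restrict L true X
count-restrict ((true ∷ E) ∷ L) false X = count-restrict L false X
count-restrict ((true ∷ E) ∷ L) true X with does (≡-dec _≟ᵇ_ E X)
... | true = cong suc (count-restrict L true X)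
... | false = count-restrict L true X

count-nil : (L : List (Subset 0)) → count L [] ≡ length L
count-nil [] = refl
count-nil ([] ∷ L) = cong suc (count-nil L)

countIf : Bool → ℕ → ℕ
countIf b = if b then suc else λ c → c

∩-false : ∀ {m} (X : Subset m) (V : Subset (suc m)) → ∣ (false ∷ X) ∩ V ∣ ≡ ∣ X ∩ tail V ∣
∩-false X (v ∷ V) = refl

∩-true : ∀ {m} c (X : Subset m) (V : Subset (suc m)) → c + ∣ (true ∷ X) ∩ V ∣ ≡ countIf (head V) c + ∣ X ∩ tail V ∣
∩-true c X (false ∷ V) = refl
∩-true c X (true ∷ V) = +-suc c _

∩-empty : (V : Subset 0) → ∣ [] ∩ V ∣ ≡ 0
∩-empty [] = refl

-- What the design must satisfy for a set of size t meeting the i-th part in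
-- hits i points and occurring c times as an edge.
Requirement : ∀ {n} → ℕ → (Fin n → ℕ) → ℕ → Set
Requirement t hits c = (t ≡ 3 → (∀ i → hits i < 3) → c ≡ 1)
                     × (t ≡ 3 → ∀ i → 3 ≤ hits i → c ≡ 0)

requirement? : ∀ {n} t (hits : Fin n → ℕ) c → Dec (Requirement t hits c)
requirement? t hits c =
  ((t ≟ℕ 3) →-dec (all? (λ i → hits i <? 3)) →-dec (c ≟ℕ 1)) ×-dec
  ((t ≟ℕ 3) →-dec (all? λ i → (3 ≤? hits i) →-dec (c ≟ℕ 0)))

Requirement-resp : ∀ {n t t' c c'} {hits hits' : Fin n → ℕ} → t ≡ t' → (∀ i → hits i ≡ hits' i) → c ≡ c' →
                   Requirement t hits c → Requirement t' hits' c'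
Requirement-resp refl hits≡ refl (one , none) =
    (λ t≡3 small → one t≡3 λ i → subst (_< 3) (sym (hits≡ i)) (small i))
  , (λ t≡3 i big → none t≡3 i (subst (3 ≤_) (sym (hits≡ i)) big))

-- The requirement for every extension X of a prefix of size `size` meeting
-- the parts in `hits` points, where `parts` and `edges` are restricted to the
-- remaining coordinates and `edges` only contains edges extending the prefix.
Extends : ∀ {m n} → ℕ → (Fin n → ℕ) → (Fin n → Subset m) → List (Subset m) → Subset m → Set
Extends size hits parts edges X =
  Requirement (size + ∣ X ∣) (λ i → hits i + ∣ X ∩ parts i ∣) (count edges X)

-- The trie walk over all subsets X of the m remaining coordinates, starting
-- from a prefix described as in `Extends`; branches are cut once the prefix
-- has more than 3 points, and at the leaves the requirement is decided.
check : ∀ m {n} → ℕ → (Fin n → ℕ) → (Fin n → Subset m) → List (Subset m) → Bool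
check zero size hits parts edges = isYes (requirement? size hits (length edges))
check (suc m) size hits parts edges with size ≤? 3
... | no _ = true
... | yes _ = check m size hits (tail ∘ parts) (restrict false edges)
            ∧ check m (suc size) (λ i → countIf (head (parts i)) (hits i)) (tail ∘ parts) (restrict true edges)

check-sound : ∀ m {n} size hits (parts : Fin n → Subset m) edges → T (check m size hits parts edges) →
              ∀ X → Extends size hits parts edges X
check-sound zero size hits parts edges ok [] =
  Requirement-resp (sym (+-identityʳ size))
                   (λ i → sym (trans (cong (hits i +_) (∩-empty (parts i))) (+-identityʳ (hits i))))
                   (sym (count-nil edges))
                   (toWitness ok)
check-sound (suc m) size hits parts edges ok (b ∷ X) with size ≤? 3
... | no size≰3 = (λ eq → ⊥-elim (size≰3 (tooBig eq))) , (λ eq → ⊥-elim (size≰3 (tooBig eq)))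
  where
  tooBig : size + ∣ b ∷ X ∣ ≡ 3 → size ≤ 3
  tooBig eq = subst (size ≤_) eq (m≤m+n size _)
... | yes _ = branch b
  where
  hitsTrue : Fin _ → ℕ
  hitsTrue i = countIf (head (parts i)) (hits i)

  okFalse : T (check m size hits (tail ∘ parts) (restrict false edges))
  okFalse = proj₁ (Equivalence.to T-∧ ok)

  okTrue : T (check m (suc size) hitsTrue (tail ∘ parts) (restrict true edges))
  okTrue = proj₂ (Equivalence.to T-∧ ok)

  branch : ∀ b → Extends size hits parts edges (b ∷ X)
  branch false = Requirement-resp refl (λ i → cong (hits i +_) (sym (∩-false X (parts i))))
                   (sym (count-restrict edges false X))
                   (check-sound m size hits (tail ∘ parts) (restrict false edges) okFalse X)
  branch true = Requirement-resp (sym (+-suc size _)) (λ i → sym (∩-true (hits i) X (parts i)))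
                  (sym (count-restrict edges true X))
                  (check-sound m (suc size) hitsTrue (tail ∘ parts) (restrict true edges) okTrue X)

stemAndGroup : ∀ {N n} → (Fin N → Maybe (Fin n)) → Fin n → Subset N
stemAndGroup lab i = StemSet lab ∪ GroupSet lab i

triplesCheck : ∀ {N n} → (Fin N → Maybe (Fin n)) → List (Block N) → Bool
triplesCheck {N} lab 𝒜 = check N 0 (λ _ → 0) (stemAndGroup lab) (concatMap blockEdges 𝒜)

certify : ∀ {g n s} (lab : Fin (g * n + s) → Maybe (Fin n)) (𝒜 : List (Block (g * n + s))) →
          True (∣ StemSet lab ∣ ≟ℕ s) →
          True (all? λ i → ∣ GroupSet lab i ∣ ≟ℕ g) →
          T (triplesCheck lab 𝒜) →
          IsCS g n s lab 𝒜
certify lab 𝒜 stemOk groupsOk triplesOk = record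
  { stemSize  = toWitness stemOk
  ; groupSize = toWitness groupsOk
  ; covered   = λ X → proj₁ (triples X)
  ; noInside  = λ X → proj₂ (triples X)
  }
  where
  triples : ∀ X → Extends 0 (λ _ → 0) (stemAndGroup lab) (concatMap blockEdges 𝒜) X
  triples = check-sound _ 0 (λ _ → 0) (stemAndGroup lab) (concatMap blockEdges 𝒜) triplesOk

consecutiveGroups : ∀ g n → Fin (g * n + 0) → Maybe (Fin n)
consecutiveGroups g n x = just (quotient g (cast (trans (+-identityʳ (g * n)) (*-comm g n)) x))

fromBlocks : ∀ g n (𝒜 : List (Block (g * n + 0))) →
             {True (∣ StemSet (consecutiveGroups g n) ∣ ≟ℕ 0)} →
             {True (all? λ i → ∣ GroupSet (consecutiveGroups g n) i ∣ ≟ℕ g)} →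
             {T (triplesCheck (consecutiveGroups g n) 𝒜)} →
             CSExists g n 0
fromBlocks g n 𝒜 {stemOk} {groupsOk} {triplesOk} =
  consecutiveGroups g n , 𝒜 , certify (consecutiveGroups g n) 𝒜 stemOk groupsOk triplesOk

blocks5×3 : List (Block 15)
blocks5×3 =
  block  0 11  6 14  3 ∷ block  7 13  9 10  2 ∷ block  3  4  6  7 14 ∷ block  3  5  0 10  2 ∷
  block  2 11  9  6  1 ∷ block  0  7  6 10  3 ∷ block  1 10  6 14  9 ∷ block 11 13  4  0  6 ∷
  block  3  5  9 13  1 ∷ block  9 11  0 12 10 ∷ block 10 11  0  1 13 ∷ block  0  7  2 12  4 ∷
  block  2 14  8 10 12 ∷ block  2  9  8 12  0 ∷ block  2 10  5 12  6 ∷ block  4  6  1 11  3 ∷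
  block  0  2  9 13  6 ∷ block  4 13  9 12  7 ∷ block  8  5  4  2 11 ∷ block  3  0  7 11  9 ∷
  block  9 10  6 12  4 ∷ block  3 12  1  6  8 ∷ block  6  8  2  0 14 ∷ block  8 14  5 11  3 ∷
  block  1  8  3 13  0 ∷ block  5 11  7 13  0 ∷ block  0  1  8  9 11 ∷ block 14 11  2  3  9 ∷
  block  1  6  2  7 14 ∷ block  2 11  7 10  5 ∷ block 12 14  0  1  7 ∷ block  2  4  6 10  8 ∷
  block  2  7  3  8 10 ∷ block  3 11  6 13  7 ∷ block  2 11  0  5  7 ∷ block  6 10  5 11  1 ∷
  block 13 14  3  4 11 ∷ block  3 14  9 12  1 ∷ block  4 12  7 14  8 ∷ block  4  1  8 12  5 ∷
  block  5  7  1  4 13 ∷ block  6 13  2 14 12 ∷ block  7 14  3 10 13 ∷ block  7 11  6 12  2 ∷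
  block  2 13  8 11  0 ∷ block  9 13  8 14  4 ∷ block  9  6  0  3 12 ∷ block  1 13  7 14 11 ∷
  block  0 14  7  9  4 ∷ block  2  3  5  6 13 ∷ block  1  2  9  5 12 ∷ block  1 10  4  9  6 ∷
  block  6 12  8 14  1 ∷ block 10 12  3  4  5 ∷ block 11 12  1  2 14 ∷ block  8 12  7 13  3 ∷
  block 12 13  2  3 10 ∷ block  8 10  4 11 14 ∷ block  4 13  2  7  9 ∷ block  3  8  4  9 11 ∷
  block 13 10  1  2  8 ∷ block  0 13  8 10  9 ∷ block 14 10  4  0 12 ∷ block  1 10  8  5  0 ∷
  block  1 14  9 11  5 ∷ block  0  5  1  6 13 ∷ block  4  0  7  8 10 ∷ block  3 10  9 11 13 ∷
  block  0 14  3  8  5 ∷ block  4  9  0  5 12 ∷ block  4 13  6  8  3 ∷ block  5 12  1 13 11 ∷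
  block  3 12  8 11  6 ∷ block  1  3  5 14  7 ∷ block  4  6  5 14  2 ∷ block  2  9  4 14  1 ∷
  block  7  9  3  1 10 ∷ block  0 14  5 13  8 ∷ block  5 14  9 10  0 ∷ block  4 11  5 12 14 ∷
  block  3 12  5  7  2 ∷ block  1 12  7 10  4 ∷ block  0 12  6 13 10 ∷ block  4 10  5 13  2 ∷
  block  1  8  7 11  4 ∷
  []

blocks5×5 : List (Block 25)
blocks5×5 =
  block  4  5  1 23 24 ∷ block  7 10 17 21 18 ∷ block 11 22 20  9  3 ∷ block 20  8 22 16 19 ∷
  block 18 22  0 14 10 ∷ block 15 22 23  5 14 ∷ block 12 17 20 21  5 ∷ block 14 17 19  6 12 ∷
  block 12 13 18  2  0 ∷ block 22  3 24 16 17 ∷ block 24  7 21 15 18 ∷ block  1  9  6 23  4 ∷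
  block  5 12 13 20  4 ∷ block 10 17 18  0  9 ∷ block 20  1 22 19 15 ∷ block  1  2  7 16 19 ∷
  block  3  4 12 17  0 ∷ block 15  0 22 13 11 ∷ block  0  9  5 11 19 ∷ block 13 19 10  7  8 ∷
  block 23 24  3 18 12 ∷ block  6  8 10 16 21 ∷ block  0  1  6 15 18 ∷ block 14 17 24  3 20 ∷
  block 16 24 21 13 19 ∷ block 19 22  4  8  0 ∷ block 21 22  5 10 23 ∷ block  3  4  8 23 17 ∷
  block  5  7 17  3 18 ∷ block 13 14 19  3  1 ∷ block 16  2  0 14  8 ∷ block 11 13 23  9 24 ∷
  block 24 20  6 12 13 ∷ block  7 15  9  3  1 ∷ block  0  7  8 15 24 ∷ block 16  4 18 12 10 ∷
  block  2  4  7 17 15 ∷ block 18 15 23  8  6 ∷ block 19 16  1 12  2 ∷ block 24 20  8 13 21 ∷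
  block 24  2  9 13  5 ∷ block  5  6 11 20 23 ∷ block  5 11  7  4  0 ∷ block 10 23 12  6  9 ∷
  block  4  1  9 19 17 ∷ block  8  9 14 23 21 ∷ block 15 24  2 11 12 ∷ block  7  8 12  2 21 ∷
  block  3  6 13 17 14 ∷ block  4  9 12 13 22 ∷ block  4  9  2 22 18 ∷ block 13 14 20  1  2 ∷
  block  0  2  9 10 15 ∷ block 14 11 21  7 22 ∷ block 14 11 19  4  2 ∷ block  0  8  5 22  3 ∷
  block 13 10 20  6 21 ∷ block  0 11 14 23 17 ∷ block 24 20  0 14 12 ∷ block 14 10 19  9  3 ∷
  block  6 12  8  0  1 ∷ block 24  5  8 17 11 ∷ block 20  2  3 10 19 ∷ block  8  9 15 21 22 ∷
  block  2  7  0 20 16 ∷ block  1  2 10 15  3 ∷ block 23  6 20 19 17 ∷ block 18 22 23  4  7 ∷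
  block 14 22 11  5  8 ∷ block 16 20  3 12 13 ∷ block  2 12  9 20 23 ∷ block 14 24 16  7  5 ∷
  block 17 18 23  7  5 ∷ block 15 20  3  4 13 ∷ block 24 20  4 19 13 ∷ block  4  6  7 19 23 ∷
  block 19 24 17 12  8 ∷ block 22  5 24 18 16 ∷ block 22 24  1  7 12 ∷ block  6 19  8  2  0 ∷
  block 20 21  0 15 14 ∷ block 22  1  2  8 11 ∷ block  3  5  6 18 22 ∷ block 19 16 23  4  9 ∷
  block 18 19 23 13  7 ∷ block  1  6 14 10 24 ∷ block  9  6 13 19 24 ∷ block  2  3 11 16  4 ∷
  block 23  1  3 15 21 ∷ block 20 22  4  5 10 ∷ block  6  8 11 21 24 ∷ block 10 11 22  3  4 ∷
  block 15 23 20 12 18 ∷ block  0  1 14 19  2 ∷ block 14 18 21  5  6 ∷ block 15 16 21  5  8 ∷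
  block  4 14  6 22 20 ∷ block  9  5 10 24 22 ∷ block  3  6  8 20  1 ∷ block  3  9  0 22 23 ∷
  block 19  0  3 12  6 ∷ block 11 19 16  8 14 ∷ block 18 19  0  6  7 ∷ block  1  2  6 21 15 ∷
  block 21 23  8 19  9 ∷ block  5  6 19 24  7 ∷ block  9  6 14 24 22 ∷ block 17 18  1  6 19 ∷
  block 23  3  6  7 16 ∷ block 17 24 20  7 11 ∷ block 23 24  7 12 20 ∷ block  4  0  9 24 18 ∷
  block 15 21 17 14 10 ∷ block 20  0  8  9 18 ∷ block  9 14 17 18  2 ∷ block 11 12 17  1  4 ∷
  block 20  0 23 18 14 ∷ block 11 12 16  6  0 ∷ block 12 14 24  5 20 ∷ block  4  7 14 18 10 ∷
  block 16 17 21 11  5 ∷ block  6  7 11  1 20 ∷ block 10 12 22  8 23 ∷ block 12 13 17  7  1 ∷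
  block  6  7 15 20  8 ∷ block  6  7 12 21 24 ∷ block 15 20 18 13  9 ∷ block 10 19 15 21  4 ∷
  block 15 16  2  8  9 ∷ block 23  3 21 16 12 ∷ block 14 18 19 20  3 ∷ block 16 22 18 10 11 ∷
  block 20  3  5 14  6 ∷ block 19 20 16 13 14 ∷ block 16 17 22  6  9 ∷ block  1  2 13 19 15 ∷
  block  2  6 14 23 24 ∷ block 17 19 21  2  7 ∷ block 24  4 22 17 13 ∷ block 11 19 21  0 22 ∷
  block 15  1  4 13  7 ∷ block 13 10 17 23  3 ∷ block 23  1  8 12  9 ∷ block 11 16 14  9  0 ∷
  block 22  1  9 18 19 ∷ block  5 10 18 19  3 ∷ block  6  7 18 24 20 ∷ block 21 22  8 14 10 ∷
  block  3 13  5 21 24 ∷ block 20  6  9 18 12 ∷ block 21  1  9  5 19 ∷ block  5 10  8  3 24 ∷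
  block 17 21 22  3  6 ∷ block 21  1 24 19 10 ∷ block  5  6 10  0 24 ∷ block 24  3  4  5 13 ∷
  block  9 13 14 15 23 ∷ block  5 18  7  1  4 ∷ block 21  0  1  7 10 ∷ block 16 18 20  1  6 ∷
  block 16 21 19 14  5 ∷ block  3  0  7 13 18 ∷ block  5 13 15 24 16 ∷ block 20 22  7 18  8 ∷
  block  6  8 18  4 19 ∷ block 21  3  4 11 15 ∷ block 24  2  4 16 22 ∷ block 19  2 16 10 13 ∷
  block 14 16 17  4  8 ∷ block 22  8  6 15 14 ∷ block  7 17 14  0  3 ∷ block 24 21  4 14 12 ∷
  block 11 12 23  4  0 ∷ block 15 24 20  1  9 ∷ block  5 14 17  1  2 ∷ block 11 24 13  7  5 ∷
  block 10 20 17  8  6 ∷ block  9 17  6  0  3 ∷ block 10 12 19 20  0 ∷ block  8 14  5  2  3 ∷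
  block 11 17 13  5  6 ∷ block 17 23 19 11 12 ∷ block  8 18 10  1  4 ∷ block  3 11  0 24 22 ∷
  block  2  8  4 21 22 ∷ block 22 23  3 12 10 ∷ block  4  1 11 22 12 ∷ block  7  8 16 21  9 ∷
  block  4  0 11 17 18 ∷ block  3  0  8 18 16 ∷ block 21  4  1 18 24 ∷ block 23 24  5 11 12 ∷
  block  0 10  7 23 21 ∷ block  7  8 19 20 21 ∷ block  6 13 14 21  0 ∷ block 10 19 22  6  7 ∷
  block  9 11 12 24  3 ∷ block  7 10 12  4  5 ∷ block  8 11 13  0  6 ∷ block  4  0  5 19 17 ∷
  block 18  4  2 11  5 ∷ block  5 13 10  2  8 ∷ block  3  7 10 24 20 ∷ block 16 21  4  0 14 ∷
  block  2 10  4 23 21 ∷ block  7  9 19  0 15 ∷ block 10 21 24  8  2 ∷ block  6 14 16 20 17 ∷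
  block 11 21 18  9  7 ∷ block 20  3  0 17 23 ∷ block 10 18 20  4 21 ∷ block 14 10 21  2  3 ∷
  block  6 10 11 17 20 ∷ block  8 13 16 17  1 ∷ block  7  9 12 22 20 ∷ block  9  5 16 22 23 ∷
  block  7 14 10 22  1 ∷ block  9 15 18  2 21 ∷ block 22  0  7 11  8 ∷ block  2  9  5 17 21 ∷
  block 13 15 16  3  7 ∷ block 21  0  8 17 18 ∷ block  6 10 18  2  3 ∷ block 17 22 15 10  6 ∷
  block  8 12 13 19 22 ∷ block  0  6  2 24 20 ∷ block 23  8  0 16 19 ∷ block  8 11 18 22 19 ∷
  block  4  8  9 10 18 ∷ block 11 12 20  0 13 ∷ block 16 17  3  9  5 ∷ block 19 23  1 10 11 ∷
  block  8  5 15  1 16 ∷ block 13 23 15  6  9 ∷ block 13 21 10  9  7 ∷ block 13 24 22  6  0 ∷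
  block  9 13 16  0  1 ∷ block 12 14 17  2  0 ∷ block 10 18 15  7 13 ∷ block 18 21  3  7  4 ∷
  block 22 23  9 10 11 ∷ block  2  5 12 16 13 ∷ block 23  2  5 19 15 ∷ block 16 20 21  2  5 ∷
  block 12 20 14  8  6 ∷ block 16 23 24  6 10 ∷ block 13 16 18  5 11 ∷ block 19 15  1  7  8 ∷
  block 10 11 15  5  4 ∷ block  0  2 12 23 13 ∷ block 18  3 20 11 14 ∷ block 13 18 11  6  2 ∷
  block 11 13 15 21  1 ∷ block  9 12 19 23 15 ∷ block  8  9 13  3 22 ∷ block 12 23 21  5  4 ∷
  block 24  9  1 17 15 ∷ block 17 21  4 13 14 ∷ block 10 15 23 24  8 ∷ block 18 20 21  8 12 ∷
  block 13 14 18  8  2 ∷ block 21  2 23 15 16 ∷ block 14 10 23  3 11 ∷ block 23  9  7 16 10 ∷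
  block 15 16 20 10  9 ∷ block 13 17 20  9  5 ∷ block 13 17 18 24  2 ∷ block  4  1  8 14 19 ∷
  block 19 15 24 14  8 ∷ block 10 11 16  0  3 ∷ block 12 13 24  0  1 ∷ block 11 15 16 22  0 ∷
  block  6 11  9  4 20 ∷ block 18 19  2  7 15 ∷ block 22 24  2 12 10 ∷ block 23 20  3 13 11 ∷
  block 20 21  9 14 22 ∷ block 23 20  2  8 13 ∷ block 10 11 24  4 12 ∷ block 16 24  1  5  2 ∷
  block  1  3 13 24 14 ∷ block 20  4  7 16 17 ∷ block 17  2 24 10 13 ∷ block 13 10 18  3  1 ∷
  block 19 23 24  0  8 ∷ block  5 15 12  3  1 ∷ block 18 23 16 11  7 ∷ block 20  5  2 18 16 ∷
  block 15 17  2 13  3 ∷ block  5 16 19  3 22 ∷ block  2  6  7 13 16 ∷ block 19 16 24  9  7 ∷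
  block  4 12  1 20 23 ∷ block 17 19  4 10  0 ∷ block  3  4 10 16 17 ∷ block  8  5 12 18 23 ∷
  block 20 21  1 10 13 ∷ block 11 13 16  1  4 ∷ block 13 18 21 22  6 ∷ block  1 14  3 22 20 ∷
  block 18  1 15 14 12 ∷ block 22  7  4 15 18 ∷ block 14 11 18 24  4 ∷ block  1 11  8 24 22 ∷
  block 22 23  6 11 24 ∷ block 14 19 12  7  3 ∷ block  1 12 10 24 18 ∷ block 22  2  5  6 15 ∷
  block 15 23  0  9  1 ∷ block  3  8 11 12 21 ∷ block 19 22 24 11 17 ∷ block 15  3 17 11 14 ∷
  block 15 17 20  5  8 ∷ block 23 20  5 16  6 ∷ block  2  3  7 22 16 ∷ block  0  9 12 21 22 ∷
  block 11 16 24 20  9 ∷ block  3  8  1 21 17 ∷ block  9 14  7  2 23 ∷ block  6 14 11  3  9 ∷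
  block 12 16 17 23  1 ∷ block  3 14 12 21 15 ∷ block  2  5  7 24  0 ∷ block 14 10 15  4  2 ∷
  block 19 15 20  9  7 ∷ block  2  3  8 17 15 ∷ block  8 10 11 23  2 ∷ block 23 24  4 13 11 ∷
  block 11 15 23  7  8 ∷ block  5  6 17 23 24 ∷ block  1  6  4 24 15 ∷ block 24  3  6 15 16 ∷
  block 24 21  3  9 14 ∷ block  2  7 10 11 20 ∷ block  4  7  9 21  2 ∷ block 21 23  0  6 11 ∷
  block  9 19 11  2  0 ∷ block 23  0  1 13 17 ∷ block 21  9 23 17 15 ∷ block 24  4  7  8 17 ∷
  block  7 18 16  0 24 ∷ block  1  9 11 15 12 ∷ block  7 11 19  3  4 ∷ block 15 17 24  0  5 ∷
  block  0  1 12 18 19 ∷ block 12 17 10  5  1 ∷ block 24  1  2 14 18 ∷ block 21  7  5 19 13 ∷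
  block 23  4 20 17 18 ∷ block  1  5  6 12 15 ∷ block 23  2  3  9 12 ∷ block  8  5 13 23 21 ∷
  block  8  9 17 22  5 ∷ block  7 11 12 18 21 ∷ block  9 12 14  1  7 ∷ block 12 22 19  5  8 ∷
  block 17 18 22 12  6 ∷ block 12 15 17  9 10 ∷ block 12 15 22  1 23 ∷ block 10 16 12  9  5 ∷
  block  1  8  9 16 20 ∷ block  9 10  6  3  4 ∷ block  0  5 13 14 23 ∷ block  0  8 10 19 11 ∷
  block 17 18  4  5  6 ∷ block 17  3  1 10  9 ∷ block  1  3  5 11 16 ∷ block  1  7  3 20 21 ∷
  block 12 16 24  8  9 ∷ block  4  8 11 20 21 ∷ block 18 24 15 12 13 ∷ block 17 22  0  1 10 ∷
  block 18 19 24  8  6 ∷ block 14 15 11  8  9 ∷ block 22  4  0 12 16 ∷ block 16  1 23 14 12 ∷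
  block  3  7  8 14 17 ∷ block  0 13  2 21 24 ∷ block  3  4  9 18 16 ∷ block 19 21 22  9 13 ∷
  block 22  0  2 19 20 ∷ block  4  0 13 18  1 ∷ block 15 16  4  9 17 ∷ block  7 13  9  1  2 ∷
  block  1  5 13 22 23 ∷ block 21 22  1 16 10 ∷ block 16 17  0  5 18 ∷ block  7  8 13 22 20 ∷
  block 18 15 22  3  8 ∷ block 20 22  0 10 13 ∷ block 18 15  0 11  1 ∷ block 21  4  6 10  7 ∷
  block 17 20  2  6  3 ∷ block  0  2  5 15 18 ∷ block  6 11 19 15  4 ∷ block  5 14 10 16 24 ∷
  block  9  5 14  4 23 ∷ block 20  4  0  6 14 ∷ block 12 18 14  6  7 ∷ block  8 16  5  4  2 ∷
  block  9  5 18 23  6 ∷ block 18 21 23 10 16 ∷ block 12 13 21  1 14 ∷ block 21  6  3 19 17 ∷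
  block 19 15  3  8 16 ∷ block 16 18 21  6  9 ∷ block 19 24  2  3 12 ∷ block 22 23  2 17 11 ∷
  block 24  0 21 18 19 ∷ block  5  7 10 20 23 ∷ block 21 22  2 11 14 ∷ block  8 12 15  4  0 ∷
  block  2  4 14 20 10 ∷ block 13 14 22  2 10 ∷ block  0  1  5 20 19 ∷ block 16 18  3 14  4 ∷
  block 13 16 23  2 24 ∷ block 14 19 22 23  7 ∷ block 17 19 22  7  5 ∷ block  4 10 13 22 16 ∷
  block  7 12 15 16  0 ∷ block 12 19 15  2  6 ∷ block  5  7 14 15 20 ∷ block  1  3  6 16 19 ∷
  block 10 15 13  8  4 ∷ block  2 13 11 20 19 ∷ block 17 20 22 14 15 ∷ block  8 13  6  1 22 ∷
  block  2  4  6 12 17 ∷ block  6 17 15  4 23 ∷ block  7 12  5  0 21 ∷ block 12 14 16 22  2 ∷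
  block 19  4 21 12 10 ∷ block  3  0 10 21 11 ∷ block  0  5  3 23 19 ∷ block 17  0 19 13 11 ∷
  block 22 24  9 15  5 ∷ block 24 21  6 17  7 ∷ block  7  9 11 17 22 ∷ block  9  6 16  2 17 ∷
  block 10 12 15  0  3 ∷ block 21 23  1 11 14 ∷ block 18 23  1  2 11 ∷ block 14 20 23  7  1 ∷
  block 22  2 20 15 11 ∷ block  6 16 13  4  2 ∷ block  2  3 14 15 16 ∷ block 11 18 19  1  5 ∷
  block  8 19 17  1 20 ∷ block 20 21  7 13 14 ∷
  []

blocks10×2 : List (Block 20)
blocks10×2 =
  block 15 17  6  7 18 ∷ block 15  6 12  8 17 ∷ block 15 16  1  3 18 ∷ block 15 18  6  2 11 ∷
  block 19  2 14  9 15 ∷ block 17 19  8  9 10 ∷ block  8 11  4 12  2 ∷ block 19 10  5  7 12 ∷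
  block  6 19  9 15 16 ∷ block 11  4 13  9 19 ∷ block  4 17  0 18  8 ∷ block 16  8 10  1  0 ∷
  block 11  3 15  6  5 ∷ block  2 15  4 10  0 ∷ block 14 16  5  6 17 ∷ block 13  6 18  3 19 ∷
  block 11 13  2  3 14 ∷ block  3 16  9 17  7 ∷ block  7 18  4 10  9 ∷ block 16 19  7  3 12 ∷
  block  1  2 17 19  4 ∷ block 13  6 19  7 17 ∷ block  2  3 18 10  5 ∷ block 10  1 17  3 12 ∷
  block  0 13  6 14  4 ∷ block 17  0 10  6  7 ∷ block 17  0 12  7 13 ∷ block  4 16  8 19 18 ∷
  block  7  0 18 14  3 ∷ block  1 14  6 11  7 ∷ block  8  0 19 10  1 ∷ block 14  5 11  7 16 ∷
  block 18  0 12  3  2 ∷ block  4  5 10 12  7 ∷ block  5 18  8 14 15 ∷ block  1  3 12 13  4 ∷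
  block 12  4 16  7  6 ∷ block 13  6 15  1 11 ∷ block 10  3 16  4 14 ∷ block 16  9 18  4 14 ∷
  block  0  3 11 17  6 ∷ block 16  9 19  5  6 ∷ block  0 13  3 19 10 ∷ block  6 18  0 11 10 ∷
  block  8 19  5 11  0 ∷ block 10  3 12  8 18 ∷ block 11 14  2  8 17 ∷ block 12 15  3  9 18 ∷
  block  6  8 17 18  9 ∷ block  9 11  3 14 13 ∷ block  2  5 13 19  8 ∷ block  6 19  8 14  4 ∷
  block 13 16  4  0 19 ∷ block 17  0 19  5 15 ∷ block 19  2 15  3 13 ∷ block  4 17  6 12  2 ∷
  block  3 14  0 16  5 ∷ block 10  3 15  0 16 ∷ block  2 15  5 11 12 ∷ block  7  9 18 19  0 ∷
  block  1 14  7 15  5 ∷ block 14 15  0  2 17 ∷ block 12  3 19  5 14 ∷ block  3  5 14 15  6 ∷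
  block  9 12  5 13  3 ∷ block 10 12  1  2 13 ∷ block 14 17  5  1 10 ∷ block  1 14  4 10 11 ∷
  block  3 16  8 13  9 ∷ block  8  1 19 15  4 ∷ block 11  4 17  5 15 ∷ block  5 17  9 10 19 ∷
  block  9 12  2 18 19 ∷ block 14  7 17  3  4 ∷ block 17 10  8  4 13 ∷ block  4 15  1 17  6 ∷
  block  1  4 12 18  7 ∷ block  9 10  6 12  1 ∷ block 11  2 18  4 13 ∷ block  3 16  6 12 13 ∷
  block  5 16  2 18  7 ∷ block 14  6 18  9  8 ∷ block 13 14  9  1 16 ∷ block 15  7 19  0  9 ∷
  block 17  0 13  1 11 ∷ block 12 14  3  4 15 ∷ block  6  9 17 13  2 ∷ block 10  2 14  5  4 ∷
  block 18  1 14  2 12 ∷ block  1 12  8 14  3 ∷ block 15  8 10  5 11 ∷ block  2 14  6 17 16 ∷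
  block 19  1 13  4  3 ∷ block  5 18  0 15  1 ∷ block 19  2 12  8  9 ∷ block  4  6 15 16  7 ∷
  block  7 10  2 17  3 ∷ block  7  8 13 15  0 ∷ block 16  9 11  6 12 ∷ block 11  4 14  0  1 ∷
  block  5  8 16 12  1 ∷ block  5 18  7 13  3 ∷ block  7 10  3 11  1 ∷ block  6 19  2 10  0 ∷
  block 12  5 17  2 18 ∷ block 19 11  0  1 12 ∷ block  2 15  8 16  6 ∷ block  8 11  1 17 18 ∷
  block 18 19  4  6 11 ∷ block  2  4 13 14  5 ∷ block 14  7 10  8 18 ∷ block 18  1 13  8 14 ∷
  block 15  8 17  3 13 ∷ block 18  1 10  6 16 ∷ block  7 19  1 12 11 ∷ block  7 10  0 16 17 ∷
  block  9 12  4 19  5 ∷ block  0  2 11 12  3 ∷ block  7 10  9 15  5 ∷ block  6 17  3 19  8 ∷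
  block 16 17  2  4 19 ∷ block 10 11  6  8 13 ∷ block 10  3 13  9  0 ∷ block  5 18  1 19  9 ∷
  block  2 13  9 15  4 ∷ block 11 12  7  9 14 ∷ block 15  8 18  4  5 ∷ block  6  7 12 14  9 ∷
  block 14  7 19  4 10 ∷ block 10 13  1  7 16 ∷ block 15  8 11  9 19 ∷ block  4 17  9 14  0 ∷
  block 19  2 11  7 17 ∷ block 12 13  8  0 15 ∷ block  8 11  3 18  4 ∷ block  3 16  5 11  1 ∷
  block  6 19  1 16  2 ∷ block 16  9 12  0 10 ∷ block 19  0 16  2 11 ∷ block 18  9 15  1 10 ∷
  block  9  2 10 16  5 ∷ block  4 17  7 13 14 ∷ block 17  8 14  0 19 ∷ block  2 15  7 12  8 ∷
  block 18 10  9  0 11 ∷ block 14  7 16  2 12 ∷ block 16 18  7  8 19 ∷ block 16  7 13  9 18 ∷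
  block  3 15  7 18 17 ∷ block  0 12  4 15 14 ∷ block 17  9 11  2  1 ∷ block  0 13  2 18  8 ∷
  block  8  9 14 16  1 ∷ block 18  1 11  7  8 ∷ block  4  7 15 11  0 ∷ block  5  7 16 17  8 ∷
  block 12  5 18  6 16 ∷ block  0 13  5 10  6 ∷ block  9  1 10 11  2 ∷ block  9 12  1 17  7 ∷
  block  3  6 14 10  9 ∷ block 13  4 10  6 15 ∷ block  0  1 16 18  3 ∷ block 13  5 17  8  7 ∷
  block  0 11  7 13  2 ∷ block 17 18  3  5 10 ∷ block 13  6 16  2  3 ∷ block  8 11  0 16  6 ∷
  block  3  4 19 11  6 ∷ block 18 11  9  5 14 ∷ block  5  6 11 13  8 ∷ block  8 10  2 13 12 ∷
  block 13 15  4  5 16 ∷ block 11  4 16  1 17 ∷ block  1 13  5 16 15 ∷ block 12  5 15  1  2 ∷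
  block 19 12  0  6 15 ∷ block 12  5 14  0 10 ∷ block  9  0 15 17  2 ∷ block  1 14  3 19  9 ∷
  []

blocks15×2 : List (Block 30)
blocks15×2 =
  block  8 28 11 23  2 ∷ block 21 27  7 13 28 ∷ block 14  3 26 28 10 ∷ block 14  6 18 24  3 ∷
  block 22 10 23  2 29 ∷ block  5  9 20 21  4 ∷ block 26 13 29  6 28 ∷ block 24 12 25  4 16 ∷
  block  8 29  7 19 17 ∷ block  7 24 10 17  9 ∷ block 21  9 28  8 26 ∷ block 15 19 12 14 26 ∷
  block 27  4 21 10 12 ∷ block 21  8 24  1 23 ∷ block  8 10 23 18 13 ∷ block 18 25  9 10 15 ∷
  block  3  5 18 28  8 ∷ block 18  9 15 13 14 ∷ block 24  1 27 13 29 ∷ block 27  3 26  8  6 ∷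
  block 28  0 16  8 15 ∷ block  8 12 19 21 10 ∷ block 16  5 21 12 14 ∷ block  3 21 14 24  5 ∷
  block 13  2 25 27  9 ∷ block 20  9 25  1  3 ∷ block  7 11 19 21  3 ∷ block 13 18  1 28  7 ∷
  block 26 13 28  9 29 ∷ block  3 25  6 22  8 ∷ block  8 25  1 15 26 ∷ block 10 16  9 21 19 ∷
  block  0  7 19 25  4 ∷ block  1  5 16 17  0 ∷ block 21 10 26  2  4 ∷ block 24 16 13  4 28 ∷
  block 18  5 26 10  6 ∷ block  3 24  2 29 27 ∷ block 11  3 15 21  0 ∷ block 22 29 11  2 26 ∷
  block 26 15  8 10 22 ∷ block  9 27 10 19  1 ∷ block  2  7 19 16  4 ∷ block 24  0 21  4  5 ∷
  block 29  4 17 14 23 ∷ block 19  7 15 10 21 ∷ block 13  5 19 20 10 ∷ block  6 23  8 19  9 ∷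
  block  1 23  4 20  6 ∷ block  4 11 25 26  1 ∷ block  9  1 15 16  6 ∷ block 23 10 16  0 11 ∷
  block  1 17  6 28 21 ∷ block 23 15 12  3 27 ∷ block  9 11 24 19 14 ∷ block 20 10 23  5 29 ∷
  block 19 25  5 11 26 ∷ block 25 12 28  5 27 ∷ block  5 26  2 15 16 ∷ block 19 11 22  8 24 ∷
  block 27  1 17  8 10 ∷ block 29 20  0  6 21 ∷ block  4 22 11 21  9 ∷ block 26  1 29 11 20 ∷
  block 27 14 29 10 15 ∷ block 29 18 11 13 25 ∷ block 15 19  0  1 29 ∷ block  7 11 18 20  9 ∷
  block 16  3 18 14 19 ∷ block  8 24 13 20 28 ∷ block 26  3 20  9 11 ∷ block 22 10 29  9 27 ∷
  block 12  1 23 25 14 ∷ block 22 13 21  3  1 ∷ block  1  8 22 23 13 ∷ block 21  8 29 13  9 ∷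
  block 12 29 14 25  0 ∷ block  9 14 26 23 11 ∷ block 29  2 21  1 19 ∷ block 19  8 24  0  2 ∷
  block 26 15 11 12 25 ∷ block  8 14 24 15  0 ∷ block 13 15  0 26  1 ∷ block 22 28  8 14 29 ∷
  block 12 15  8 18 14 ∷ block  4 21  7 29  6 ∷ block 11 27  1 23 16 ∷ block 25 12 27  8 28 ∷
  block 12  3 28 19  4 ∷ block  4  6 19 29  9 ∷ block 22 26  3  5 24 ∷ block  3 24  0 28 29 ∷
  block 21  7 26  3 11 ∷ block  9 26  2 16 27 ∷ block 13 20  1 17  3 ∷ block 14 15  4 26 19 ∷
  block 13 19 12 24 22 ∷ block 23  0 17  6  8 ∷ block 19  5 24  1  9 ∷ block 15 20  2 14 17 ∷
  block 18 20  3 13 23 ∷ block  6 28  9 25 11 ∷ block  4  8 19 20  3 ∷ block 10 28  6 16 12 ∷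
  block 18 23  5  2 20 ∷ block 13 19 10 23 24 ∷ block  6 24 13 23 11 ∷ block 10  0 27 24 12 ∷
  block  7 11 22 23  6 ∷ block 20 26  6 12 27 ∷ block 22  9 25  2 24 ∷ block  7 12 24 21  9 ∷
  block  0  5 17 29  2 ∷ block  8 26  9 18  0 ∷ block  5 12 24 15  9 ∷ block  1  7 17 23  8 ∷
  block 26  2 23  6  7 ∷ block 10  1 26 17  2 ∷ block 25  2 19  8 10 ∷ block 13 15  6 20 16 ∷
  block 28 15 13  8 18 ∷ block  1  8 20 26  5 ∷ block  2 23  1 28 26 ∷ block  7  9 22 17 12 ∷
  block 28 20  2  8 17 ∷ block 15  1 20 12  5 ∷ block 17  6 22 13  0 ∷ block 26 16 13 10 28 ∷
  block 18 10 21  7 23 ∷ block 22 12 25  7 16 ∷ block  2  8 18 24  9 ∷ block 17 21 13  0 19 ∷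
  block 26 17 12  3 18 ∷ block 21  9 17 12 23 ∷ block 28 20  4  5 25 ∷ block 14 19  2 29  8 ∷
  block 18  6 29  9 20 ∷ block  7 29  1 20 22 ∷ block  0  6 16 22  7 ∷ block 24 28  6  8 20 ∷
  block  0 22  9 28 15 ∷ block  6 26  9 21  0 ∷ block  8 12 23 24  7 ∷ block  4 22  0 25  6 ∷
  block  4 24  7 19 13 ∷ block  0  4 15 16 14 ∷ block 22 27  9  6 24 ∷ block  2 19  4 15  5 ∷
  block  8 25 11 18 10 ∷ block 24 11 26  7 27 ∷ block 26 13 19  3 14 ∷ block 29  5 28 10  8 ∷
  block  8 25 10 21 11 ∷ block  3  8 20 17  5 ∷ block  3 20 11 25 21 ∷ block 27 14 15  7 29 ∷
  block  2 21  7 28 15 ∷ block 18  5 21 13 20 ∷ block  4 25  3 15 28 ∷ block 21 12 20  2  0 ∷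
  block 25 16 11  2 17 ∷ block 17  5 24  4 22 ∷ block  3  7 29 16  5 ∷ block 27 17 14 11 29 ∷
  block 16  3 19 11 18 ∷ block 13  2 28 29 12 ∷ block 28  2 18  9 11 ∷ block 12  4 16 22  1 ∷
  block  9 13 20 22 11 ∷ block  9 15  6 19 20 ∷ block 10 26  0 22 15 ∷ block 16  7 15 12 10 ∷
  block 22 11 27  3  5 ∷ block 11 18  5 24 26 ∷ block  3 19  8 15 23 ∷ block 25  2 28 14 15 ∷
  block 23 15 14  0 20 ∷ block 10 17 13 29  0 ∷ block 13 29  3 25 18 ∷ block 20 24  5  6 19 ∷
  block  8 12 20 22  4 ∷ block  1  5 28 15 12 ∷ block  9 13 21 23  5 ∷ block 21 13 15  4  6 ∷
  block  1  3 16 26  6 ∷ block 16  4 27  7 18 ∷ block 16  4 17 11 23 ∷ block 10 27 12 23 13 ∷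
  block 20 27 11 12 17 ∷ block 11 15  1 22 24 ∷ block 12  2 29 26 14 ∷ block 24 16  0  1 21 ∷
  block  6 23  9 16  8 ∷ block 15 22  6  7 27 ∷ block 28  3 16 13 22 ∷ block  5 11 21 27 12 ∷
  block 27 14 20  4  0 ∷ block  2 24  5 21  7 ∷ block 22 26  7  8 21 ∷ block 11 28 13 24 14 ∷
  block  0  4 27 29 11 ∷ block 23 11 19 14 25 ∷ block 14  4 16 28  1 ∷ block 13 20  7 26 28 ∷
  block 23 14 22  4  2 ∷ block  2 19 10 24 20 ∷ block  6 13 25 16 10 ∷ block 28  5 22 11 13 ∷
  block  8 15 11 27 13 ∷ block 23 27  5  7 19 ∷ block 25  0 28 10 19 ∷ block 24 26  9  4 29 ∷
  block 18 24  4 10 25 ∷ block 18 22  3  4 17 ∷ block 29  6 23 12 14 ∷ block  2 20 13 23  4 ∷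
  block  1 23 10 29 16 ∷ block 17  9 20  6 22 ∷ block 13  3 15 27  0 ∷ block  2 20  3 27  9 ∷
  block 27 16 12 13 26 ∷ block  2 23 14 27 28 ∷ block 28  1 20  0 18 ∷ block  7 13 23 29 14 ∷
  block 18  5 20  1 21 ∷ block  2  6 29 16 13 ∷ block 20  8 27  7 25 ∷ block  6 12 22 28 13 ∷
  block  9 15  8 20 18 ∷ block 16 20  1  2 15 ∷ block 10 29  0 21 23 ∷ block 19 26 10 11 16 ∷
  block 11  3 17 18  8 ∷ block 29  1 16 12 17 ∷ block  4 26 13 17 19 ∷ block 23 10 26  3 25 ∷
  block 24 11 17  1 12 ∷ block 28  1 24  4 15 ∷ block  9 13 24 25  8 ∷ block 29  5 26  9 10 ∷
  block 10  2 16 17  7 ∷ block 18  6 19 13 25 ∷ block 14 16  2 24  1 ∷ block  4 20  9 16 24 ∷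
  block 26 18  2  3 23 ∷ block 29 18 10 12 16 ∷ block  7 29 10 26 12 ∷ block 15  5 18  0 24 ∷
  block 16 20 12 14 18 ∷ block 28 18  0 12 15 ∷ block 16 18  1 11 21 ∷ block  3 21 10 20  8 ∷
  block  4  9 21 18  6 ∷ block 16  4 23  3 21 ∷ block 14 16  7 21 17 ∷ block 28 17 10 12 24 ∷
  block 29 21  5  6 26 ∷ block 17  4 25  9  5 ∷ block  4 10 20 26 11 ∷ block 21 23  6  1 26 ∷
  block 21 25  2  4 23 ∷ block  7 14 26 17 11 ∷ block  0  2 15 25  5 ∷ block  6 25 11 17 19 ∷
  block 10 16  7 20 21 ∷ block 22 10 18 13 24 ∷ block 17  8 29 12 13 ∷ block 10 15 13 25  4 ∷
  block 20  7 22  3 23 ∷ block  9 26 11 22 12 ∷ block 11  0 23 25  7 ∷ block  6 11 23 20  8 ∷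
  block 20 25  7  4 22 ∷ block  0 18  1 25  7 ∷ block  3  7 15 17 14 ∷ block  3 21  4 28 10 ∷
  block  0 21 12 25 26 ∷ block 10 14 22 24  6 ∷ block 13 16  9 19  0 ∷ block 24 14 27  9 18 ∷
  block 18  9 17 14 12 ∷ block  7 26 12 18 20 ∷ block  1  6 18 15  3 ∷ block  1 19  8 18  6 ∷
  block 18  7 23 14  1 ∷ block 26  3 29  0 16 ∷ block 12  1 27 28 11 ∷ block 14  3 25 27  1 ∷
  block 19 24  6  3 21 ∷ block  3  7 18 19  2 ∷ block  2  4 17 27  7 ∷ block  7 14 28 29  4 ∷
  block 25 11 15  7  0 ∷ block 10 28 11 20  2 ∷ block 13  5 17 23  2 ∷ block 11 28  4 18 29 ∷
  block 16 23  5 11 20 ∷ block  0 21 14 26 24 ∷ block 18 22 14  1 20 ∷ block 17 23  3  9 24 ∷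
  block 12 28  2 24 17 ∷ block 27  4 15  1 17 ∷ block 17 24  6 12 21 ∷ block  6 10 18 20  2 ∷
  block 12 29  0 22 14 ∷ block  1 18  4 26  3 ∷ block  9 26 12 19 11 ∷ block 23 25  8  3 28 ∷
  block 25 17  1  2 22 ∷ block  5  7 20 15 10 ∷ block 19  7 20 14 26 ∷ block 24  0 23  5  3 ∷
  block  6 27  5 17 15 ∷ block 18  8 21  3 27 ∷ block 23 27  8  9 22 ∷ block 21  9 22  1 28 ∷
  block 20 24  1  3 22 ∷ block 17  4 20 12 19 ∷ block  5 24 10 16 18 ∷ block 18 22  0  2 29 ∷
  block 27 16  9 11 23 ∷ block 15  2 18 10 17 ∷ block  3 10 22 28  7 ∷ block 18 25  7 13 22 ∷
  block 17  9 26  0  2 ∷ block 17 21 14  1 28 ∷ block  7 25  8 17 14 ∷ block 28 17  9 11 15 ∷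
  block 17 22  4  1 19 ∷ block  8 13 25 22 10 ∷ block 12  4 18 19  9 ∷ block 18  6 25  5 23 ∷
  block  4  8 15 17  6 ∷ block 10 12 25 20  0 ∷ block 19  6 27 11  7 ∷ block 16  6 19  1 25 ∷
  block 28  1 29  8 20 ∷ block 22 13 19  2  3 ∷ block 25  1 24  6  4 ∷ block  8 26  4 29 10 ∷
  block 27 13 17  9  2 ∷ block  1 19 12 22  3 ∷ block 13 16 14 23  5 ∷ block  6 24  7 16 13 ∷
  block  1 18  9 23 19 ∷ block  5 25  8 20 14 ∷ block  6 24  2 27  8 ∷ block  4 26  7 23  9 ∷
  block  3 23  6 18 12 ∷ block 16 23  7  8 28 ∷ block  5 22  7 18  8 ∷ block  2 19  5 27  4 ∷
  block  2  9 21 27  6 ∷ block 16  8 25 14  1 ∷ block 23 10 25  6 26 ∷ block 12 29  5 19 15 ∷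
  block 13  0 28 23  3 ∷ block 22 29 13 14 19 ∷ block 25 13 17 12 15 ∷ block 11 18 14 15  1 ∷
  block 14 16  1 27  2 ∷ block 12 19  6 25 27 ∷ block  2 18  7 29 22 ∷ block  4 25  1 29 15 ∷
  block 10 28  2 27  0 ∷ block 12 15  4 29  2 ∷ block 20 27  9  0 24 ∷ block  1 19  2 26  8 ∷
  block 16 21  3  0 18 ∷ block  7 24  9 20 10 ∷ block 22  8 27  4 12 ∷ block 26 18  0  6 15 ∷
  block 29  3 19 10 12 ∷ block 21 28 10  1 25 ∷ block 21 25  6  7 20 ∷ block 17  8 16 13 11 ∷
  block 23 11 15 10 28 ∷ block 12 17  0 27  6 ∷ block 15  7 24 13  0 ∷ block 19 11 28  2  4 ∷
  block  5 23  1 26  7 ∷ block 24 12 20  0 26 ∷ block 20 11 17  0  1 ∷ block 19  6 21  2 22 ∷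
  block 14 20 11 24 25 ∷ block  7 24  0 29 25 ∷ block  1 22  0 27 25 ∷ block 13 16  5 15  3 ∷
  block 27  2 15 12 21 ∷ block  3 22  8 29 16 ∷ block 14 18  4 25 27 ∷ block 20  8 16 11 22 ∷
  block  0 17  8 22 18 ∷ block 20 11 19  1 14 ∷ block  5 23  6 15 12 ∷ block  8 29  5 18 19 ∷
  block  5 22  8 15  7 ∷ block 11  0 26 27 10 ∷ block 19  6 22 14 21 ∷ block 20  7 28 12  8 ∷
  block 14 17  6 16  4 ∷ block 15  2 23  7  3 ∷ block 17  7 20  2 26 ∷ block 22 26  4  6 18 ∷
  block 27 18 13  4 19 ∷ block 19 23  0  2 21 ∷ block 24 13 29  5  7 ∷ block  9  1 28 19 13 ∷
  block 14  1 29 24  4 ∷ block  5  9 16 18  7 ∷ block 20  7 23  0 22 ∷ block 15  6 29 11  9 ∷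
  block 28  4 27  9  7 ∷ block  9 16  3 22 24 ∷ block  9 16 12 28 14 ∷ block  7 23 12 19 27 ∷
  block 22 24  7  2 27 ∷ block 29  6 17  3 19 ∷ block  9 29 12 24  3 ∷ block 19 10 16 14  0 ∷
  block 15  3 26  6 17 ∷ block  1 21  4 16 10 ∷ block 14  5 15 21  6 ∷ block 10  2 29 20 14 ∷
  block  7 28  4 17 18 ∷ block  1 22 13 26 27 ∷ block 28  0 15 11 16 ∷ block 14 20 13 25 23 ∷
  block  5 22 13 27 23 ∷ block 27  0 19 14 17 ∷ block 10 14 25 26  9 ∷ block 17 24  8  9 29 ∷
  block 23 14 20  3  4 ∷ block  5  9 17 19  1 ∷ block 23  9 28  5 13 ∷ block 17 19  2 12 22 ∷
  block 25 13 26  5 17 ∷ block  3 20  6 28  5 ∷ block 29  2 15  9 21 ∷ block 21 13 24 10 26 ∷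
  block 19  7 26  6 24 ∷ block 29 19  1 13 16 ∷ block 10 17  4 23 25 ∷ block 25 12 18  2 13 ∷
  block 20  6 25  2 10 ∷ block 22 14 16  5  7 ∷ block 20 24  2  4 16 ∷ block 24 12 16 11 29 ∷
  block 12  1 24 26  8 ∷ block 19  9 22  4 28 ∷ block 12 15 13 22  4 ∷ block 11 28 14 21 13 ∷
  block 14 21  2 18  4 ∷ block 24 28  9 10 23 ∷ block  6 23 14 28 24 ∷ block 21  8 23  4 24 ∷
  block 14 17  0 24  6 ∷ block  6 10 21 22  5 ∷ block 23  0 26 12 28 ∷ block 15 22  4 10 19 ∷
  block 17  4 19  0 20 ∷ block 15  2 17 13 18 ∷ block  6  8 21 16 11 ∷ block 20 12 29  3  5 ∷
  block 11 16 14 26  5 ∷ block 24 10 29  6 14 ∷ block 21 25  3  5 17 ∷ block 25 29  6  8 27 ∷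
  block  9 25 14 21 29 ∷ block 25 15 12  9 27 ∷ block  0 18 11 21  2 ∷ block  4 21 12 26 22 ∷
  block  4 21  6 17  7 ∷ block  4 11 23 29  8 ∷ block  3 10 24 25  0 ∷ block 14 21  8 27 29 ∷
  block 18 10 27  1  3 ∷ block  3 25 12 16 18 ∷ block 11  2 27 18  3 ∷ block  8  0 27 18 12 ∷
  block 27 29 12  7 17 ∷ block 15  6 27 10 11 ∷ block  9 27  5 15 11 ∷ block  7 28  6 18 16 ∷
  block 16  7 28 11 12 ∷ block 16 22  2  8 23 ∷ block  6 28  0 19 21 ∷ block  6 22 11 18 26 ∷
  block 16  8 19  5 21 ∷ block  5 27  8 24 10 ∷ block  2 24 11 15 17 ∷ block 13  4 29 20  5 ∷
  block  1  5 27 29  3 ∷ block  8 27 13 19 21 ∷ block  2  9 23 24 14 ∷ block  0 22  3 19  5 ∷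
  block 11  1 28 25 13 ∷ block 12 19  0 16  2 ∷ block  0  7 21 22 12 ∷ block 19 10 18  0 13 ∷
  block 11 17  8 21 22 ∷ block 23 29  9  0 15 ∷ block  9  0 25 16  1 ∷ block  5 27 14 18 20 ∷
  block 23 13 26  8 17 ∷ block 14  6 20 21 11 ∷ block 29  2 25  5 16 ∷ block  2  6 17 18  1 ∷
  block 27 19  1  7 16 ∷ block 24 28  5  7 26 ∷ block  5 23 12 22 10 ∷ block 24 15 10  1 16 ∷
  block 27 16  8 10 29 ∷ block 12 14 27 22  2 ∷ block 19 21  4 14 24 ∷ block 23 12 28  4  6 ∷
  block 26 14 18 13 16 ∷ block 15 21  1  7 22 ∷ block 14 17 10 20  1 ∷ block 25 27 10  5 15 ∷
  block  4  8 16 18  0 ∷ block 20 22  5  0 25 ∷ block  0 19  5 26 28 ∷ block 25  1 22  5  6 ∷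
  block  7 25 14 24 12 ∷ block 29 21  3  9 18 ∷ block 20 12 23  9 25 ∷ block 11 29 12 21  3 ∷
  block 15 19 11 13 17 ∷ block  9 27  1 26 14 ∷ block  5 10 22 19  7 ∷ block 24 29 11  8 26 ∷
  block 26 12 16  8  1 ∷ block  0 17  2 28  3 ∷ block 26 14 27  6 18 ∷ block 25 14 15  6  8 ∷
  block 10 27 13 20 12 ∷ block  6 13 27 28  3 ∷ block 27  3 24  7  8 ∷ block  0 17  3 25  2 ∷
  block 16 20 13  0 27 ∷ block 12 16  2 23 25 ∷ block 11 17 10 22 20 ∷ block  4 23  9 15 17 ∷
  block  6 27  3 16 17 ∷ block 27 19  3  4 24 ∷ block  9 28 14 20 22 ∷ block  5 21 10 17 25 ∷
  block  2 22  5 17 11 ∷ block 17  3 22 14  7 ∷ block 24 11 27  4 26 ∷ block 20  8 21  0 27 ∷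
  block 11 29  7 17 13 ∷ block 26  0 16  7  9 ∷ block 25 13 21  1 27 ∷ block 26 15  7  9 28 ∷
  block 28  5 16  2 18 ∷ block 12 18 11 23 21 ∷ block 15  7 18  4 20 ∷ block 15  4 20 11 13 ∷
  block 19 23  4  5 18 ∷ block  7 25  3 28  9 ∷ block 11 29  3 28  1 ∷ block  0 20  3 15  9 ∷
  block 15 17  0 10 20 ∷ block 28 19 14  5 20 ∷ block 13 17  3 24 26 ∷ block  8 26  0 25 13 ∷
  block  5 26  4 16 29 ∷ block 14  3 29 15 13 ∷ block 25 17 14  5 29 ∷ block 29  0 19 11  4 ∷
  block 17  5 28  8 19 ∷ block 16  3 24  8  4 ∷ block 26  2 25  7  5 ∷ block  0  4 26 28  2 ∷
  block  8  0 29 15  5 ∷ block 26 28 11  6 16 ∷ block  1 20  6 27 29 ∷ block 22  9 15 14 10 ∷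
  block 24  1 18  7  9 ∷ block  2 20  9 19  7 ∷ block 22  9 24  5 25 ∷ block 16  2 21 13  6 ∷
  block  7 27 10 22  1 ∷ block  3 20  5 16  6 ∷ block 10 14 21 23 12 ∷ block  4 22  5 29 11 ∷
  block 23 28 10  7 25 ∷ block  2  6 28 15  4 ∷ block 13  2 24 26  0 ∷ block 25 29 10 11 24 ∷
  block 15  3 22  2 20 ∷ block 15  3 16 10 22 ∷ block 28 14 18 10  3 ∷ block 21 26  8  5 23 ∷
  block 17 21  2  3 16 ∷ block 10 27  3 17 28 ∷ block 12 18  9 22 23 ∷ block 21 12 18  1  2 ∷
  block 28  4 25  8  9 ∷ block 25 29  7  9 21 ∷ block 28 17 13 14 27 ∷ block  6 10 17 19  8 ∷
  block 19 23  1  3 15 ∷ block 23 27  4  6 25 ∷ block 21 11 24  6 15 ∷ block 29 16 14  9 19 ∷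
  block  8 15  2 21 23 ∷ block  3  9 19 25 10 ∷ block 11  0 22 24 13 ∷ block 19 26  8 14 23 ∷
  block 28  0 21  5  1 ∷ block  0 16  5 27 20 ∷ block 23 11 24  3 15 ∷ block 27  0 23  3 29 ∷
  block 29  1 17  9 16 ∷ block 26 14 22  2 28 ∷ block  1 18  3 29  4 ∷ block 29  1 22  6  2 ∷
  block  0 18  7 17  5 ∷ block 21 28 12 13 18 ∷ block 27  0 28  7 19 ∷ block 29 18 14  0 28 ∷
  block 22 14 25 11 27 ∷ block 18  4 23  0  8 ∷ block 11 13 26 21  1 ∷ block 17  5 18 12 24 ∷
  block 13 15  1 23  0 ∷ block  5 12 26 27  2 ∷
  []

lemma3p4 : CSExists 5 3 0 × CSExists 5 5 0 × CSExists 10 2 0 × CSExists 15 2 0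
lemma3p4 = fromBlocks 5 3 blocks5×3
         , fromBlocks 5 5 blocks5×5
         , fromBlocks 10 2 blocks10×2
         , fromBlocks 15 2 blocks15×2
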